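{- Let $\mathcal{M}=(E,r)$ be a matroid and $D,D_1,\ldots,D_s\subseteq E$ such that $\mathcal{M}|_D=\bigoplus_{i=1}^s\mathcal{M}|_{D_i}$. Then $D$ is a $k$-fold circuit if and only if each $D_i$ is a $k_i$-fold circuit and $k=\sum_{i=1}^s k_i$. Moreover, if each $D_i$ has principal partition $\mathcal{A}_i$, then the principal partition of $D$ is $\bigcup_{i=1}^s\mathcal{A}_i$.
   Context: Matroids have finite ground sets. $\mathcal{M}|_D=\bigoplus_{i}\mathcal{M}|_{D_i}$ means $D$ is the disjoint union of the $D_i$ and $r(X)=\sum_i r(X\cap D_i)$ for all $X\subseteq D$. A cyclic set is a set $D$ with $r(D-e)=r(D)$ for all $e\in D$; a $k$-fold circuit is a cyclic set with $r(D)=|D|-k$. The principal partition of a $k$-fold circuit $D$ is $\{D\setminus B: B\subseteq D\text{ a }(k-1)\text{ -fold circuit}\}$, which is a partition of $D$. -}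

module Defs where

open import Data.Nat using (ℕ; suc; _+_; _≤_)
open import Data.Fin using (Fin)
open import Data.Fin.Subset using (Subset; _∈_; _⊆_; _∩_; _∪_; _─_; _-_; ⋃; ∣_∣; ⊥)
open import Data.List using (List)
import Data.List as List
import Data.Vec as Vec
open import Data.Product using (Σ; _×_; ∃; ∃-syntax)
open import Relation.Binary.PropositionalEquality using (_≡_)
open import Relation.Nullary using (¬_)
open import Function.Bundles using (_⇔_)

record Matroid (n : ℕ) : Set where
  field
    r          : Subset n → ℕ
    r-bounded  : ∀ X → r X ≤ ∣ X ∣
    r-mono     : ∀ X Y → X ⊆ Y → r X ≤ r Y
    r-submod   : ∀ X Y → r (X ∪ Y) + r (X ∩ Y) ≤ r X + r Y
open Matroid public

Σᶠ : (s : ℕ) → (Fin s → ℕ) → ℕ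
Σᶠ s f = Vec.sum (Vec.tabulate f)

⋃ᶠ : ∀ {n} (s : ℕ) → (Fin s → Subset n) → Subset n
⋃ᶠ s D = ⋃ (List.tabulate D)

IsDirectSum : ∀ {n} (M : Matroid n) (D : Subset n) (s : ℕ) (Ds : Fin s → Subset n) → Set
IsDirectSum M D s Ds =
  (D ≡ ⋃ᶠ s Ds)
  × (∀ i j → ¬ (i ≡ j) → Ds i ∩ Ds j ≡ ⊥)
  × (∀ X → X ⊆ D → r M X ≡ Σᶠ s (λ i → r M (X ∩ Ds i)))

IsCyclic : ∀ {n} (M : Matroid n) (D : Subset n) → Set
IsCyclic M D = ∀ e → e ∈ D → r M (D - e) ≡ r M D

IsKFoldCircuit : ∀ {n} (M : Matroid n) (k : ℕ) (D : Subset n) → Set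
IsKFoldCircuit M k D = IsCyclic M D × (r M D + k ≡ ∣ D ∣)

-- 𝒜 is the principal partition of D: D is a k-fold circuit and
-- 𝒜 = { D ∖ B : B ⊆ D a (k-1)-fold circuit }  (empty when k = 0).
IsPrincipalPartition : ∀ {n} (M : Matroid n) (D : Subset n) (𝒜 : Subset n → Set) → Set
IsPrincipalPartition M D 𝒜 =
  Σ ℕ λ k → IsKFoldCircuit M k D ×
    (∀ A → 𝒜 A ⇔ (∃[ B ] ∃[ j ] (B ⊆ D × suc j ≡ k × IsKFoldCircuit M j B × A ≡ D ─ B)))

-- Write ν X = ∣X∣ − r X for the nullity, so that a k-fold circuit is exactly a cyclic set of
-- nullity k. Over a direct sum, rank and cardinality both split along the components, hence so
-- does nullity. Deleting a point x lowers the rank of no piece, so r (X − x) = r X iff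
-- r (X ∩ Dᵢ − x) = r (X ∩ Dᵢ) for every i: X is cyclic iff all its pieces are.
--
-- For the principal partition, let B ⊆ D be a (k−1)-fold circuit with k = Σ kᵢ. Its pieces
-- are cyclic with ν (B ∩ Dᵢ) ≤ ν Dᵢ = kᵢ and these nullities sum to k − 1, so exactly one
-- piece, say i, loses one and the others keep full nullity. Removing a point from a cyclic set
-- drops its nullity, so a subset of a cyclic Dₗ with the same nullity is all of Dₗ: hence B
-- contains every Dₗ with l ≠ i, and D ─ B = Dᵢ ─ (B ∩ Dᵢ) is a block of Dᵢ. Conversely a
-- block Dᵢ ─ Bᵢ of Dᵢ is the block D ─ B of D for B = (D ─ Dᵢ) ∪ Bᵢ.

module Submission where

open import Defs
open import Data.Nat using (ℕ; zero; suc; _+_; _∸_; _≤_)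
open import Data.Nat.Properties hiding (_≟_)
open import Algebra.Properties.CommutativeSemigroup +-commutativeSemigroup
  using () renaming (interchange to +-interchange)
open import Data.Fin using (Fin; zero; suc; _≟_)
import Data.Fin.Properties as Fin
open import Data.Fin.Subset
  using (Subset; _∈_; _∉_; _⊆_; _∩_; _∪_; _─_; _-_; ⁅_⁆; ∣_∣; ⊥; inside; outside)
open import Data.Fin.Subset.Properties
open import Data.Vec using ([]; _∷_; here; there)
open import Data.Product using (_×_; _,_; proj₁; proj₂; ∃-syntax)
import Data.Product as Product
open import Data.Sum using (inj₁; inj₂)
open import Function using (_∘_)
open import Function.Bundles using (_⇔_; mk⇔; Equivalence)
open import Relation.Binary.PropositionalEquality
open import Relation.Nullary using (yes; no; contradiction)

private
  variable
    n : ℕ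

Σᶠ-cong : ∀ s {f g : Fin s → ℕ} → (∀ i → f i ≡ g i) → Σᶠ s f ≡ Σᶠ s g
Σᶠ-cong zero    f≡g = refl
Σᶠ-cong (suc s) f≡g = cong₂ _+_ (f≡g zero) (Σᶠ-cong s (f≡g ∘ suc))

Σᶠ-distrib-+ : ∀ s (f g : Fin s → ℕ) → Σᶠ s (λ i → f i + g i) ≡ Σᶠ s f + Σᶠ s g
Σᶠ-distrib-+ zero    f g = refl
Σᶠ-distrib-+ (suc s) f g = trans
  (cong (f zero + g zero +_) (Σᶠ-distrib-+ s (f ∘ suc) (g ∘ suc)))
  (+-interchange (f zero) (g zero) _ _)

Σᶠ-mono-≤ : ∀ s {f g : Fin s → ℕ} → (∀ i → f i ≤ g i) → Σᶠ s f ≤ Σᶠ s g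
Σᶠ-mono-≤ zero    f≤g = ≤-refl
Σᶠ-mono-≤ (suc s) f≤g = +-mono-≤ (f≤g zero) (Σᶠ-mono-≤ s (f≤g ∘ suc))

+-≤-≡⇒≡ : ∀ {a b c d} → a ≤ b → c ≤ d → a + c ≡ b + d → a ≡ b × c ≡ d
+-≤-≡⇒≡ {a} {b} {c} {d} a≤b c≤d eq = a≡b , +-cancelˡ-≡ a c d (trans eq (cong (_+ d) (sym a≡b)))
  where
  a≡b : a ≡ b
  a≡b = ≤-antisym a≤b (+-cancelʳ-≤ c b a (≤-trans (+-monoʳ-≤ b c≤d) (≤-reflexive (sym eq))))

suc[m+n]≡m+o⇒suc[n]≡o : ∀ m {n o} → suc (m + n) ≡ m + o → suc n ≡ o
suc[m+n]≡m+o⇒suc[n]≡o m eq = +-cancelˡ-≡ m _ _ (trans (+-suc m _) eq)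

Σᶠ-≤-≡⇒≡ : ∀ s {f g : Fin s → ℕ} → (∀ i → f i ≤ g i) → Σᶠ s f ≡ Σᶠ s g → ∀ i → f i ≡ g i
Σᶠ-≤-≡⇒≡ (suc s) f≤g eq zero    = proj₁ (+-≤-≡⇒≡ (f≤g zero) (Σᶠ-mono-≤ s (f≤g ∘ suc)) eq)
Σᶠ-≤-≡⇒≡ (suc s) f≤g eq (suc i) =
  Σᶠ-≤-≡⇒≡ s (f≤g ∘ suc) (proj₂ (+-≤-≡⇒≡ (f≤g zero) (Σᶠ-mono-≤ s (f≤g ∘ suc)) eq)) i

Σᶠ-suc-update : ∀ s {f g : Fin s → ℕ} i → suc (f i) ≡ g i → (∀ l → l ≢ i → f l ≡ g l) →
                suc (Σᶠ s f) ≡ Σᶠ s g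
Σᶠ-suc-update (suc s) zero    eqᵢ eq = cong₂ _+_ eqᵢ (Σᶠ-cong s (λ l → eq (suc l) λ ()))
Σᶠ-suc-update (suc s) (suc i) eqᵢ eq = trans (sym (+-suc _ _)) (cong₂ _+_ (eq zero λ ())
  (Σᶠ-suc-update s i eqᵢ (λ l l≢i → eq (suc l) (l≢i ∘ Fin.suc-injective))))

Σᶠ-suc-split : ∀ s {f g : Fin s → ℕ} → (∀ i → f i ≤ g i) → suc (Σᶠ s f) ≡ Σᶠ s g →
               ∃[ i ] (suc (f i) ≡ g i × ∀ l → l ≢ i → f l ≡ g l)
Σᶠ-suc-split (suc s) {f} {g} f≤g eq with m≤n⇒m<n∨m≡n (f≤g zero)
... | inj₁ f₀<g₀ =
  let head≡ , tail≡ = +-≤-≡⇒≡ f₀<g₀ (Σᶠ-mono-≤ s (f≤g ∘ suc)) eq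
  in zero , head≡ , λ { zero 0≢0 → contradiction refl 0≢0
                      ; (suc l) _ → Σᶠ-≤-≡⇒≡ s (f≤g ∘ suc) tail≡ l }
... | inj₂ f₀≡g₀ with Σᶠ-suc-split s (f≤g ∘ suc)
                        (suc[m+n]≡m+o⇒suc[n]≡o (f zero) (trans eq (cong (_+ _) (sym f₀≡g₀))))
...   | i , eqᵢ , eq = suc i , eqᵢ , λ { zero _ → f₀≡g₀
                                       ; (suc l) l≢i → eq l (l≢i ∘ cong suc) }

x∈p─q⁻ : ∀ {x : Fin n} (p q : Subset n) → x ∈ p ─ q → x ∈ p × x ∉ q
x∈p─q⁻            (inside  ∷ p) (outside ∷ q) here = here , λ ()
x∈p─q⁻ {x = zero} (inside  ∷ p) (inside  ∷ q) ()
x∈p─q⁻ {x = zero} (outside ∷ p) (inside  ∷ q) ()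
x∈p─q⁻ {x = zero} (outside ∷ p) (outside ∷ q) ()
x∈p─q⁻            (_       ∷ p) (_       ∷ q) (there x∈p─q) =
  Product.map there (λ x∉q → x∉q ∘ drop-there) (x∈p─q⁻ p q x∈p─q)

x∈p─q⁺ : ∀ {x : Fin n} {p q : Subset n} → x ∈ p × x ∉ q → x ∈ p ─ q
x∈p─q⁺ (x∈p , x∉q) = x∈p∧x∉q⇒x∈p─q x∈p x∉q

∣p∣≡∣p∩q∣+∣p─q∣ : ∀ (p q : Subset n) → ∣ p ∣ ≡ ∣ p ∩ q ∣ + ∣ p ─ q ∣
∣p∣≡∣p∩q∣+∣p─q∣ []            []            = refl
∣p∣≡∣p∩q∣+∣p─q∣ (inside  ∷ p) (inside  ∷ q) = cong suc (∣p∣≡∣p∩q∣+∣p─q∣ p q)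
∣p∣≡∣p∩q∣+∣p─q∣ (inside  ∷ p) (outside ∷ q) =
  trans (cong suc (∣p∣≡∣p∩q∣+∣p─q∣ p q)) (sym (+-suc _ _))
∣p∣≡∣p∩q∣+∣p─q∣ (outside ∷ p) (inside  ∷ q) = ∣p∣≡∣p∩q∣+∣p─q∣ p q
∣p∣≡∣p∩q∣+∣p─q∣ (outside ∷ p) (outside ∷ q) = ∣p∣≡∣p∩q∣+∣p─q∣ p q

q⊆p⇒p∩q≡q : ∀ {p q : Subset n} → q ⊆ p → p ∩ q ≡ q
q⊆p⇒p∩q≡q {p = p} {q} q⊆p = ⊆-antisym (p∩q⊆q p q) (λ x∈q → x∈p∩q⁺ (q⊆p x∈q , x∈q))

p⊆q⇒∣q∣≡∣p∣+∣q─p∣ : ∀ {p q : Subset n} → p ⊆ q → ∣ q ∣ ≡ ∣ p ∣ + ∣ q ─ p ∣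
p⊆q⇒∣q∣≡∣p∣+∣q─p∣ {p = p} {q} p⊆q =
  trans (∣p∣≡∣p∩q∣+∣p─q∣ q p) (cong (λ X → ∣ X ∣ + ∣ q ─ p ∣) (q⊆p⇒p∩q≡q p⊆q))

x∈p⇒∣p∣≡1+∣p-x∣ : ∀ {x : Fin n} {p : Subset n} → x ∈ p → ∣ p ∣ ≡ suc ∣ p - x ∣
x∈p⇒∣p∣≡1+∣p-x∣ {x = x} {p} x∈p =
  trans (p⊆q⇒∣q∣≡∣p∣+∣q─p∣ ⁅x⁆⊆p) (cong (_+ ∣ p - x ∣) (∣⁅x⁆∣≡1 x))
  where
  ⁅x⁆⊆p : ⁅ x ⁆ ⊆ p
  ⁅x⁆⊆p y∈⁅x⁆ = subst (_∈ p) (sym (x∈⁅y⁆⇒x≡y x y∈⁅x⁆)) x∈p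

p⊆q∪[p─q] : ∀ (p q : Subset n) → p ⊆ q ∪ (p ─ q)
p⊆q∪[p─q] p q {x} x∈p with x ∈? q
... | yes x∈q = x∈p∪q⁺ (inj₁ x∈q)
... | no  x∉q = x∈p∪q⁺ (inj₂ (x∈p─q⁺ (x∈p , x∉q)))

[p─q]∩r≡[p∩r]─q : ∀ (p q r : Subset n) → (p ─ q) ∩ r ≡ (p ∩ r) ─ q
[p─q]∩r≡[p∩r]─q p q r = ⊆-antisym
  (λ x∈ → let x∈p─q , x∈r = x∈p∩q⁻ (p ─ q) r x∈
              x∈p , x∉q = x∈p─q⁻ p q x∈p─q
          in x∈p─q⁺ (x∈p∩q⁺ (x∈p , x∈r) , x∉q))
  (λ x∈ → let x∈p∩r , x∉q = x∈p─q⁻ (p ∩ r) q x∈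
              x∈p , x∈r = x∈p∩q⁻ p r x∈p∩r
          in x∈p∩q⁺ (x∈p─q⁺ (x∈p , x∉q) , x∈r))

p─q≡p : ∀ {p q : Subset n} → (∀ {x} → x ∈ p → x ∉ q) → p ─ q ≡ p
p─q≡p {p = p} {q} disjoint = ⊆-antisym (p─q⊆p p q) (λ x∈p → x∈p─q⁺ (x∈p , disjoint x∈p))

x∉p⇒p-x≡p : ∀ {x : Fin n} {p : Subset n} → x ∉ p → p - x ≡ p
x∉p⇒p-x≡p {x = x} x∉p = p─q≡p λ y∈p y∈⁅x⁆ → x∉p (subst (_∈ _) (x∈⁅y⁆⇒x≡y x y∈⁅x⁆) y∈p)

PairwiseDisjoint : ∀ {s} → (Fin s → Subset n) → Set
PairwiseDisjoint Ds = ∀ {i j x} → x ∈ Ds i → x ∈ Ds j → i ≡ j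

x∈⋃ᶠ⁺ : ∀ s (Ds : Fin s → Subset n) {i x} → x ∈ Ds i → x ∈ ⋃ᶠ s Ds
x∈⋃ᶠ⁺ (suc s) Ds {zero}  x∈D₀ = x∈p∪q⁺ (inj₁ x∈D₀)
x∈⋃ᶠ⁺ (suc s) Ds {suc i} x∈Dᵢ = x∈p∪q⁺ (inj₂ (x∈⋃ᶠ⁺ s (Ds ∘ suc) x∈Dᵢ))

x∈⋃ᶠ⁻ : ∀ s (Ds : Fin s → Subset n) {x} → x ∈ ⋃ᶠ s Ds → ∃[ i ] x ∈ Ds i
x∈⋃ᶠ⁻ zero    Ds x∈⊥ = contradiction x∈⊥ ∉⊥
x∈⋃ᶠ⁻ (suc s) Ds x∈⋃ with x∈p∪q⁻ (Ds zero) (⋃ᶠ s (Ds ∘ suc)) x∈⋃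
... | inj₁ x∈D₀ = zero , x∈D₀
... | inj₂ x∈⋃′ = let i , x∈Dᵢ = x∈⋃ᶠ⁻ s (Ds ∘ suc) x∈⋃′ in suc i , x∈Dᵢ

∣p∣≡Σᶠ∣p∩Dsᵢ∣ : ∀ {n} s {Ds : Fin s → Subset n} → PairwiseDisjoint Ds →
                ∀ {X} → X ⊆ ⋃ᶠ s Ds → ∣ X ∣ ≡ Σᶠ s (λ i → ∣ X ∩ Ds i ∣)
∣p∣≡Σᶠ∣p∩Dsᵢ∣ {n} zero _ {X} X⊆⊥ =
  trans (cong ∣_∣ (⊆-antisym X⊆⊥ ⊥⊆)) (∣⊥∣≡0 n)
∣p∣≡Σᶠ∣p∩Dsᵢ∣ (suc s) {Ds} disjoint {X} X⊆⋃ = begin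
  ∣ X ∣
    ≡⟨ ∣p∣≡∣p∩q∣+∣p─q∣ X (Ds zero) ⟩
  ∣ X ∩ Ds zero ∣ + ∣ X ─ Ds zero ∣
    ≡⟨ cong (∣ X ∩ Ds zero ∣ +_) (∣p∣≡Σᶠ∣p∩Dsᵢ∣ s disjoint′ rest⊆) ⟩
  ∣ X ∩ Ds zero ∣ + Σᶠ s (λ i → ∣ (X ─ Ds zero) ∩ Ds (suc i) ∣)
    ≡⟨ cong (∣ X ∩ Ds zero ∣ +_) (Σᶠ-cong s (cong ∣_∣ ∘ drop-D₀)) ⟩
  ∣ X ∩ Ds zero ∣ + Σᶠ s (λ i → ∣ X ∩ Ds (suc i) ∣)
    ∎
  where
  open ≡-Reasoning
  disjoint′ : PairwiseDisjoint (Ds ∘ suc)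
  disjoint′ x∈Dᵢ x∈Dⱼ = Fin.suc-injective (disjoint x∈Dᵢ x∈Dⱼ)
  rest⊆ : X ─ Ds zero ⊆ ⋃ᶠ s (Ds ∘ suc)
  rest⊆ x∈ with x∈p─q⁻ X (Ds zero) x∈
  ... | x∈X , x∉D₀ with x∈p∪q⁻ (Ds zero) _ (X⊆⋃ x∈X)
  ...   | inj₁ x∈D₀ = contradiction x∈D₀ x∉D₀
  ...   | inj₂ x∈⋃′ = x∈⋃′
  drop-D₀ : ∀ i → (X ─ Ds zero) ∩ Ds (suc i) ≡ X ∩ Ds (suc i)
  drop-D₀ i = trans ([p─q]∩r≡[p∩r]─q X (Ds zero) (Ds (suc i)))
    (p─q≡p λ x∈ x∈D₀ → Fin.0≢1+n (disjoint x∈D₀ (proj₂ (x∈p∩q⁻ X _ x∈))))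

module _ (M : Matroid n) where

  nullity : Subset n → ℕ
  nullity X = ∣ X ∣ ∸ r M X

  r+nullity≡∣∣ : ∀ X → r M X + nullity X ≡ ∣ X ∣
  r+nullity≡∣∣ X = m+[n∸m]≡n (r-bounded M X)

  kFold⇒≡nullity : ∀ {k X} → IsKFoldCircuit M k X → k ≡ nullity X
  kFold⇒≡nullity {k} {X} (_ , r+k≡∣X∣) =
    +-cancelˡ-≡ (r M X) k _ (trans r+k≡∣X∣ (sym (r+nullity≡∣∣ X)))

  cyclic⇒kFold : ∀ {X} → IsCyclic M X → IsKFoldCircuit M (nullity X) X
  cyclic⇒kFold {X} X-cyclic = X-cyclic , r+nullity≡∣∣ X

  r-∪-≤ : ∀ X Y → r M (X ∪ Y) ≤ r M X + r M Y
  r-∪-≤ X Y = m+n≤o⇒m≤o _ (r-submod M X Y)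

  nullity-mono : ∀ {Y Z} → Y ⊆ Z → nullity Y ≤ nullity Z
  nullity-mono {Y} {Z} Y⊆Z = +-cancelˡ-≤ (r M Z) _ _ (begin
    r M Z + nullity Y                   ≤⟨ +-monoˡ-≤ (nullity Y) r[Z]≤ ⟩
    r M Y + ∣ Z ─ Y ∣ + nullity Y       ≡⟨ +-assoc (r M Y) _ _ ⟩
    r M Y + (∣ Z ─ Y ∣ + nullity Y)     ≡⟨ cong (r M Y +_) (+-comm ∣ Z ─ Y ∣ _) ⟩
    r M Y + (nullity Y + ∣ Z ─ Y ∣)     ≡⟨ +-assoc (r M Y) _ _ ⟨
    r M Y + nullity Y + ∣ Z ─ Y ∣       ≡⟨ cong (_+ ∣ Z ─ Y ∣) (r+nullity≡∣∣ Y) ⟩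
    ∣ Y ∣ + ∣ Z ─ Y ∣                   ≡⟨ p⊆q⇒∣q∣≡∣p∣+∣q─p∣ Y⊆Z ⟨
    ∣ Z ∣                               ≡⟨ r+nullity≡∣∣ Z ⟨
    r M Z + nullity Z                   ∎)
    where
    open ≤-Reasoning
    r[Z]≤ : r M Z ≤ r M Y + ∣ Z ─ Y ∣
    r[Z]≤ = begin
      r M Z               ≤⟨ r-mono M Z _ (p⊆q∪[p─q] Z Y) ⟩
      r M (Y ∪ (Z ─ Y))   ≤⟨ r-∪-≤ Y (Z ─ Y) ⟩
      r M Y + r M (Z ─ Y) ≤⟨ +-monoʳ-≤ (r M Y) (r-bounded M (Z ─ Y)) ⟩
      r M Y + ∣ Z ─ Y ∣   ∎

  cyclic⇒r[X-x]≡r[X] : ∀ {X} → IsCyclic M X → ∀ x → r M (X - x) ≡ r M X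
  cyclic⇒r[X-x]≡r[X] {X} X-cyclic x with x ∈? X
  ... | yes x∈X = X-cyclic x x∈X
  ... | no  x∉X = cong (r M) (x∉p⇒p-x≡p x∉X)

  cyclic⇒nullity[X]≡1+nullity[X-x] : ∀ {X x} → IsCyclic M X → x ∈ X → nullity X ≡ suc (nullity (X - x))
  cyclic⇒nullity[X]≡1+nullity[X-x] {X} {x} X-cyclic x∈X = begin
    ∣ X ∣ ∸ r M X                 ≡⟨ cong₂ _∸_ (x∈p⇒∣p∣≡1+∣p-x∣ x∈X) (sym (X-cyclic x x∈X)) ⟩
    suc ∣ X - x ∣ ∸ r M (X - x)   ≡⟨ +-∸-assoc 1 (r-bounded M (X - x)) ⟩
    suc (nullity (X - x))         ∎
    where open ≡-Reasoning

  cyclic-⊆-nullity≡⇒⊇ : ∀ {Y Z} → IsCyclic M Z → Y ⊆ Z → nullity Y ≡ nullity Z → Z ⊆ Y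
  cyclic-⊆-nullity≡⇒⊇ {Y} {Z} Z-cyclic Y⊆Z ν≡ {x} x∈Z with x ∈? Y
  ... | yes x∈Y = x∈Y
  ... | no  x∉Y = contradiction ν≡ (<⇒≢ (begin-strict
    nullity Y             ≤⟨ nullity-mono Y⊆Z-x ⟩
    nullity (Z - x)       <⟨ n<1+n _ ⟩
    suc (nullity (Z - x)) ≡⟨ cyclic⇒nullity[X]≡1+nullity[X-x] Z-cyclic x∈Z ⟨
    nullity Z             ∎))
    where
    open ≤-Reasoning
    Y⊆Z-x : Y ⊆ Z - x
    Y⊆Z-x {y} y∈Y = x∈p∧x≢y⇒x∈p-y (Y⊆Z y∈Y) λ { refl → x∉Y y∈Y }

CircuitFoldsSumTo : ∀ {s} → Matroid n → (Fin s → Subset n) → ℕ → Set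
CircuitFoldsSumTo {s = s} M Xs k = ∃[ ks ] ((∀ i → IsKFoldCircuit M (ks i) (Xs i)) × k ≡ Σᶠ s ks)

IsPrincipalBlock : Matroid n → ℕ → Subset n → Subset n → Set
IsPrincipalBlock M k D A =
  ∃[ B ] ∃[ j ] (B ⊆ D × suc j ≡ k × IsKFoldCircuit M j B × A ≡ D ─ B)

module DirectSum (M : Matroid n) {D : Subset n} {s : ℕ} {Ds : Fin s → Subset n}
                 (direct : IsDirectSum M D s Ds) where

  private
    D≡⋃ : D ≡ ⋃ᶠ s Ds
    D≡⋃ = proj₁ direct

    r-additive : ∀ X → X ⊆ D → r M X ≡ Σᶠ s (λ i → r M (X ∩ Ds i))
    r-additive = proj₂ (proj₂ direct)

  disjoint : PairwiseDisjoint Ds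
  disjoint {i} {j} {x} x∈Dᵢ x∈Dⱼ with i ≟ j
  ... | yes i≡j = i≡j
  ... | no  i≢j =
    contradiction (subst (x ∈_) (proj₁ (proj₂ direct) i j i≢j) (x∈p∩q⁺ (x∈Dᵢ , x∈Dⱼ))) ∉⊥

  Dsᵢ⊆D : ∀ i → Ds i ⊆ D
  Dsᵢ⊆D i x∈Dᵢ = subst (_ ∈_) (sym D≡⋃) (x∈⋃ᶠ⁺ s Ds x∈Dᵢ)

  x∈D⇒x∈Dsᵢ : ∀ {x} → x ∈ D → ∃[ i ] x ∈ Ds i
  x∈D⇒x∈Dsᵢ x∈D = x∈⋃ᶠ⁻ s Ds (subst (_ ∈_) D≡⋃ x∈D)

  D∩Dsᵢ≡Dsᵢ : ∀ i → D ∩ Ds i ≡ Ds i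
  D∩Dsᵢ≡Dsᵢ i = q⊆p⇒p∩q≡q (Dsᵢ⊆D i)

  nullity-additive : ∀ {X} → X ⊆ D → nullity M X ≡ Σᶠ s (λ i → nullity M (X ∩ Ds i))
  nullity-additive {X} X⊆D = +-cancelˡ-≡ (r M X) _ _ (begin
    r M X + nullity M X
      ≡⟨ r+nullity≡∣∣ M X ⟩
    ∣ X ∣
      ≡⟨ ∣p∣≡Σᶠ∣p∩Dsᵢ∣ s disjoint (subst (X ⊆_) D≡⋃ X⊆D) ⟩
    Σᶠ s (λ i → ∣ X ∩ Ds i ∣)
      ≡⟨ Σᶠ-cong s (λ i → r+nullity≡∣∣ M (X ∩ Ds i)) ⟨
    Σᶠ s (λ i → r M (X ∩ Ds i) + νᵢ i)
      ≡⟨ Σᶠ-distrib-+ s _ νᵢ ⟩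
    Σᶠ s (λ i → r M (X ∩ Ds i)) + Σᶠ s νᵢ
      ≡⟨ cong (_+ Σᶠ s νᵢ) (r-additive X X⊆D) ⟨
    r M X + Σᶠ s νᵢ
      ∎)
    where
    open ≡-Reasoning
    νᵢ : Fin s → ℕ
    νᵢ i = nullity M (X ∩ Ds i)

  cyclic⇔ : ∀ {X} → X ⊆ D → IsCyclic M X ⇔ (∀ i → IsCyclic M (X ∩ Ds i))
  cyclic⇔ {X} X⊆D = mk⇔ to from
    where
    open ≡-Reasoning

    r[X-x]≡Σr[Xᵢ-x] : ∀ x → r M (X - x) ≡ Σᶠ s (λ i → r M ((X ∩ Ds i) - x))
    r[X-x]≡Σr[Xᵢ-x] x = begin
      r M (X - x)
        ≡⟨ r-additive (X - x) (X⊆D ∘ p─q⊆p X ⁅ x ⁆) ⟩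
      Σᶠ s (λ i → r M ((X - x) ∩ Ds i))
        ≡⟨ Σᶠ-cong s (λ i → cong (r M) ([p─q]∩r≡[p∩r]─q X ⁅ x ⁆ (Ds i))) ⟩
      Σᶠ s (λ i → r M ((X ∩ Ds i) - x))
        ∎

    to : IsCyclic M X → ∀ i → IsCyclic M (X ∩ Ds i)
    to X-cyclic i x x∈Xᵢ = Σᶠ-≤-≡⇒≡ s (λ j → r-mono M _ _ (p─q⊆p (X ∩ Ds j) ⁅ x ⁆)) (begin
      Σᶠ s (λ j → r M ((X ∩ Ds j) - x)) ≡⟨ r[X-x]≡Σr[Xᵢ-x] x ⟨
      r M (X - x)                       ≡⟨ X-cyclic x (proj₁ (x∈p∩q⁻ X (Ds i) x∈Xᵢ)) ⟩
      r M X                             ≡⟨ r-additive X X⊆D ⟩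
      Σᶠ s (λ j → r M (X ∩ Ds j))       ∎) i

    from : (∀ i → IsCyclic M (X ∩ Ds i)) → IsCyclic M X
    from pieces-cyclic x _ = begin
      r M (X - x)
        ≡⟨ r[X-x]≡Σr[Xᵢ-x] x ⟩
      Σᶠ s (λ i → r M ((X ∩ Ds i) - x))
        ≡⟨ Σᶠ-cong s (λ i → cyclic⇒r[X-x]≡r[X] M (pieces-cyclic i) x) ⟩
      Σᶠ s (λ i → r M (X ∩ Ds i))
        ≡⟨ r-additive X X⊆D ⟨
      r M X
        ∎

  kFoldCircuit⇔ : ∀ {k X} → X ⊆ D → IsKFoldCircuit M k X ⇔ CircuitFoldsSumTo M (λ i → X ∩ Ds i) k
  kFoldCircuit⇔ {k} {X} X⊆D = mk⇔ to from
    where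
    to : IsKFoldCircuit M k X → CircuitFoldsSumTo M (λ i → X ∩ Ds i) k
    to X-circuit@(X-cyclic , _) =
        (λ i → nullity M (X ∩ Ds i))
      , (λ i → cyclic⇒kFold M (Equivalence.to (cyclic⇔ X⊆D) X-cyclic i))
      , trans (kFold⇒≡nullity M X-circuit) (nullity-additive X⊆D)

    from : CircuitFoldsSumTo M (λ i → X ∩ Ds i) k → IsKFoldCircuit M k X
    from (ks , pieces , k≡Σks) = subst (λ k → IsKFoldCircuit M k X) (sym k≡ν)
      (cyclic⇒kFold M (Equivalence.from (cyclic⇔ X⊆D) (proj₁ ∘ pieces)))
      where
      k≡ν : k ≡ nullity M X
      k≡ν = begin
        k                                   ≡⟨ k≡Σks ⟩
        Σᶠ s ks                             ≡⟨ Σᶠ-cong s (kFold⇒≡nullity M ∘ pieces) ⟩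
        Σᶠ s (λ i → nullity M (X ∩ Ds i))   ≡⟨ nullity-additive X⊆D ⟨
        nullity M X                         ∎
        where open ≡-Reasoning

  kFoldCircuit⇔-components : ∀ {k} → IsKFoldCircuit M k D ⇔ CircuitFoldsSumTo M Ds k
  kFoldCircuit⇔-components {k} = mk⇔
    (λ D-circuit → let ks , pieces , k≡Σks = Equivalence.to (kFoldCircuit⇔ ⊆-refl) D-circuit
                   in ks , (λ i → subst (IsKFoldCircuit M (ks i)) (D∩Dsᵢ≡Dsᵢ i) (pieces i)) , k≡Σks)
    (λ (ks , pieces , k≡Σks) → Equivalence.from (kFoldCircuit⇔ ⊆-refl)
      (ks , (λ i → subst (IsKFoldCircuit M (ks i)) (sym (D∩Dsᵢ≡Dsᵢ i)) (pieces i)) , k≡Σks))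

  D─B≡Dsᵢ─[B∩Dsᵢ] : ∀ {B i} → (∀ l → l ≢ i → Ds l ⊆ B) → D ─ B ≡ Ds i ─ (B ∩ Ds i)
  D─B≡Dsᵢ─[B∩Dsᵢ] {B} {i} Dₗ⊆B = ⊆-antisym D─B⊆ ⊇D─B
    where
    D─B⊆ : D ─ B ⊆ Ds i ─ (B ∩ Ds i)
    D─B⊆ x∈D─B with x∈p─q⁻ D B x∈D─B
    ... | x∈D , x∉B with x∈D⇒x∈Dsᵢ x∈D
    ...   | l , x∈Dₗ with l ≟ i
    ...     | yes refl = x∈p─q⁺ (x∈Dₗ , x∉B ∘ proj₁ ∘ x∈p∩q⁻ B (Ds i))
    ...     | no  l≢i  = contradiction (Dₗ⊆B l l≢i x∈Dₗ) x∉B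
    ⊇D─B : Ds i ─ (B ∩ Ds i) ⊆ D ─ B
    ⊇D─B x∈ with x∈p─q⁻ (Ds i) (B ∩ Ds i) x∈
    ... | x∈Dᵢ , x∉B∩Dᵢ = x∈p─q⁺ (Dsᵢ⊆D i x∈Dᵢ , λ x∈B → x∉B∩Dᵢ (x∈p∩q⁺ (x∈B , x∈Dᵢ)))

  D[_≔_] : Fin s → Subset n → Subset n
  D[ i ≔ B ] = (D ─ Ds i) ∪ B

  D[i≔B]⊆D : ∀ {i B} → B ⊆ Ds i → D[ i ≔ B ] ⊆ D
  D[i≔B]⊆D {i} {B} B⊆Dᵢ x∈ with x∈p∪q⁻ (D ─ Ds i) B x∈
  ... | inj₁ x∈D─Dᵢ = p─q⊆p D (Ds i) x∈D─Dᵢ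
  ... | inj₂ x∈B    = Dsᵢ⊆D i (B⊆Dᵢ x∈B)

  D[i≔B]∩Dsᵢ≡B : ∀ {i B} → B ⊆ Ds i → D[ i ≔ B ] ∩ Ds i ≡ B
  D[i≔B]∩Dsᵢ≡B {i} {B} B⊆Dᵢ = ⊆-antisym ⊆B (λ x∈B → x∈p∩q⁺ (x∈p∪q⁺ (inj₂ x∈B) , B⊆Dᵢ x∈B))
    where
    ⊆B : D[ i ≔ B ] ∩ Ds i ⊆ B
    ⊆B x∈ with x∈p∩q⁻ D[ i ≔ B ] (Ds i) x∈
    ... | x∈D[i≔B] , x∈Dᵢ with x∈p∪q⁻ (D ─ Ds i) B x∈D[i≔B]
    ...   | inj₁ x∈D─Dᵢ = contradiction x∈Dᵢ (proj₂ (x∈p─q⁻ D (Ds i) x∈D─Dᵢ))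
    ...   | inj₂ x∈B    = x∈B

  Dsₗ⊆D[i≔B] : ∀ {i B} l → l ≢ i → Ds l ⊆ D[ i ≔ B ]
  Dsₗ⊆D[i≔B] l l≢i x∈Dₗ = x∈p∪q⁺ (inj₁ (x∈p─q⁺ (Dsᵢ⊆D l x∈Dₗ , l≢i ∘ disjoint x∈Dₗ)))

  principalBlock-lift : ∀ {ks : Fin s → ℕ} {i A} → (∀ l → IsKFoldCircuit M (ks l) (Ds l)) →
                        IsPrincipalBlock M (ks i) (Ds i) A → IsPrincipalBlock M (Σᶠ s ks) D A
  principalBlock-lift {ks} {i} {A} circuits (Bᵢ , j , Bᵢ⊆Dᵢ , 1+j≡kᵢ , Bᵢ-circuit , A≡Dᵢ─Bᵢ) =
    B , nullity M B , B⊆D , 1+ν[B]≡Σks , cyclic⇒kFold M B-cyclic , A≡D─B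
    where
    B : Subset n
    B = D[ i ≔ Bᵢ ]

    B⊆D : B ⊆ D
    B⊆D = D[i≔B]⊆D Bᵢ⊆Dᵢ

    B∩Dᵢ≡Bᵢ : B ∩ Ds i ≡ Bᵢ
    B∩Dᵢ≡Bᵢ = D[i≔B]∩Dsᵢ≡B Bᵢ⊆Dᵢ

    B∩Dₗ≡Dₗ : ∀ l → l ≢ i → B ∩ Ds l ≡ Ds l
    B∩Dₗ≡Dₗ l l≢i = q⊆p⇒p∩q≡q (Dsₗ⊆D[i≔B] l l≢i)

    piece-cyclic : ∀ l → IsCyclic M (B ∩ Ds l)
    piece-cyclic l with l ≟ i
    ... | yes refl = subst (IsCyclic M) (sym B∩Dᵢ≡Bᵢ) (proj₁ Bᵢ-circuit)
    ... | no  l≢i  = subst (IsCyclic M) (sym (B∩Dₗ≡Dₗ l l≢i)) (proj₁ (circuits l))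

    B-cyclic : IsCyclic M B
    B-cyclic = Equivalence.from (cyclic⇔ B⊆D) piece-cyclic

    1+νᵢ≡kᵢ : suc (nullity M (B ∩ Ds i)) ≡ ks i
    1+νᵢ≡kᵢ = begin
      suc (nullity M (B ∩ Ds i)) ≡⟨ cong (λ X → suc (nullity M X)) B∩Dᵢ≡Bᵢ ⟩
      suc (nullity M Bᵢ)         ≡⟨ cong suc (kFold⇒≡nullity M Bᵢ-circuit) ⟨
      suc j                      ≡⟨ 1+j≡kᵢ ⟩
      ks i                       ∎
      where open ≡-Reasoning

    νₗ≡kₗ : ∀ l → l ≢ i → nullity M (B ∩ Ds l) ≡ ks l
    νₗ≡kₗ l l≢i = trans (cong (nullity M) (B∩Dₗ≡Dₗ l l≢i)) (sym (kFold⇒≡nullity M (circuits l)))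

    1+ν[B]≡Σks : suc (nullity M B) ≡ Σᶠ s ks
    1+ν[B]≡Σks = trans (cong suc (nullity-additive B⊆D)) (Σᶠ-suc-update s i 1+νᵢ≡kᵢ νₗ≡kₗ)

    A≡D─B : A ≡ D ─ B
    A≡D─B = begin
      A                   ≡⟨ A≡Dᵢ─Bᵢ ⟩
      Ds i ─ Bᵢ           ≡⟨ cong (Ds i ─_) B∩Dᵢ≡Bᵢ ⟨
      Ds i ─ (B ∩ Ds i)   ≡⟨ D─B≡Dsᵢ─[B∩Dsᵢ] Dsₗ⊆D[i≔B] ⟨
      D ─ B               ∎
      where open ≡-Reasoning

  principalBlock-restrict : ∀ {ks : Fin s → ℕ} {A} → (∀ l → IsKFoldCircuit M (ks l) (Ds l)) →
                            IsPrincipalBlock M (Σᶠ s ks) D A →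
                            ∃[ i ] IsPrincipalBlock M (ks i) (Ds i) A
  principalBlock-restrict {ks} {A} circuits (B , j , B⊆D , 1+j≡Σks , B-circuit , A≡D─B) =
    restrictTo (Σᶠ-suc-split s νₗ≤kₗ 1+Σν≡Σks)
    where
    ν : Fin s → ℕ
    ν l = nullity M (B ∩ Ds l)

    piece-cyclic : ∀ l → IsCyclic M (B ∩ Ds l)
    piece-cyclic = Equivalence.to (cyclic⇔ B⊆D) (proj₁ B-circuit)

    νₗ≤kₗ : ∀ l → ν l ≤ ks l
    νₗ≤kₗ l = subst (ν l ≤_) (sym (kFold⇒≡nullity M (circuits l))) (nullity-mono M (p∩q⊆q B (Ds l)))

    1+Σν≡Σks : suc (Σᶠ s ν) ≡ Σᶠ s ks
    1+Σν≡Σks = begin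
      suc (Σᶠ s ν)      ≡⟨ cong suc (nullity-additive B⊆D) ⟨
      suc (nullity M B) ≡⟨ cong suc (kFold⇒≡nullity M B-circuit) ⟨
      suc j             ≡⟨ 1+j≡Σks ⟩
      Σᶠ s ks           ∎
      where open ≡-Reasoning

    restrictTo : ∃[ i ] (suc (ν i) ≡ ks i × ∀ l → l ≢ i → ν l ≡ ks l) →
                 ∃[ i ] IsPrincipalBlock M (ks i) (Ds i) A
    restrictTo (i , 1+νᵢ≡kᵢ , νₗ≡kₗ) =
      i , B ∩ Ds i , ν i , p∩q⊆q B (Ds i) , 1+νᵢ≡kᵢ , cyclic⇒kFold M (piece-cyclic i) ,
      trans A≡D─B (D─B≡Dsᵢ─[B∩Dsᵢ] Dₗ⊆B)
      where
      Dₗ⊆B : ∀ l → l ≢ i → Ds l ⊆ B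
      Dₗ⊆B l l≢i = p∩q⊆p B (Ds l) ∘ cyclic-⊆-nullity≡⇒⊇ M (proj₁ (circuits l)) (p∩q⊆q B (Ds l))
        (trans (νₗ≡kₗ l l≢i) (kFold⇒≡nullity M (circuits l)))

  principalPartition-⋃ : (𝒜 : Fin s → Subset n → Set) →
                         (∀ i → IsPrincipalPartition M (Ds i) (𝒜 i)) →
                         IsPrincipalPartition M D (λ A → ∃[ i ] 𝒜 i A)
  principalPartition-⋃ 𝒜 partitions =
    Σᶠ s ks , Equivalence.from kFoldCircuit⇔-components (ks , circuits , refl) , λ A → mk⇔
      (λ (i , A∈𝒜ᵢ) → principalBlock-lift circuits (Equivalence.to (blocks i A) A∈𝒜ᵢ))
      (λ A-block → let i , A-blockᵢ = principalBlock-restrict circuits A-block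
                   in i , Equivalence.from (blocks i A) A-blockᵢ)
    where
    ks : Fin s → ℕ
    ks i = proj₁ (partitions i)

    circuits : ∀ i → IsKFoldCircuit M (ks i) (Ds i)
    circuits i = proj₁ (proj₂ (partitions i))

    blocks : ∀ i A → 𝒜 i A ⇔ IsPrincipalBlock M (ks i) (Ds i) A
    blocks i = proj₂ (proj₂ (partitions i))

mainTheorem9 : ∀ {n} (M : Matroid n) (D : Subset n) (s : ℕ) (Ds : Fin s → Subset n)
  → IsDirectSum M D s Ds
  → (∀ (k : ℕ) → IsKFoldCircuit M k D
       ⇔ (∃[ ks ] ((∀ i → IsKFoldCircuit M (ks i) (Ds i)) × k ≡ Σᶠ s ks)))
    × (∀ (𝒜 : Fin s → Subset n → Set)
       → (∀ i → IsPrincipalPartition M (Ds i) (𝒜 i))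
       → IsPrincipalPartition M D (λ A → ∃[ i ] 𝒜 i A))
mainTheorem9 M D s Ds direct = (λ k → kFoldCircuit⇔-components) , principalPartition-⋃
  where open DirectSum M direct
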